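{- Let $G=(L,R,E)$ be a finite bipartite graph whose vertex sets $L$ and $R$ are each equipped with a linear ordering (preference relation) $\succ$. Then $G$ has exactly one greedy matching, i.e., among all maximal matchings $M$ of $G$, exactly one has the property that $v_M$ is reachable from $v_\emptyset$ in the digraph $D_G$ defined below.
   Context: For $x\in L,y\in R$ write $x\sim y$ if $\{x,y\}\in E$; $a\succ b$ means $a$ is preferred over $b$. For a matching $M\subseteq E$, let $L_M\subseteq L$ be the set of vertices of $L$ not matched by $M$ that are adjacent to at least one vertex of $R$ not matched by $M$; define $R_M\subseteq R$ analogously. The digraph $D_G=(V,A)$ has vertex set $V=\{v_M : M\subseteq E \text{ a matching in } G\}$ (including the empty matching), and contains the arc $(v_M,v_{M'})$ iff $L_M$ and $R_M$ are nonempty and $M'=M\cup\{\{x^*,y^*\}\}$ where at least one of the following holds: (L-condition) $x^*$ is the most preferred vertex of $L_M$ and $y^*$ is the most preferred vertex of $\{y\in R_M: y\sim x^*\}$; (R-condition) $y^*$ is the most preferred vertex of $R_M$ and $x^*$ is the most preferred vertex of $\{x\in L_M : x\sim y^*\}$. A vertex $b$ is reachable from $a$ if $D_G$ contains a directed path from $a$ to $b$ (possibly of length $0$). A matching $M$ is a greedy matching if $v_M$ is a sink of $D_G$ (equivalently, $M$ is a maximal matching) and $v_M$ is reachable from $v_\emptyset$. -}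

module Defs where

open import Data.Nat using (ℕ)
open import Data.Fin using (Fin; _≟_)
open import Data.Bool using (Bool; true; false; _∨_; _∧_)
open import Data.Product using (Σ; ∃; _×_; _,_)
open import Data.Sum using (_⊎_)
open import Relation.Nullary using (¬_)
open import Relation.Nullary.Decidable using (⌊_⌋)
open import Relation.Binary.PropositionalEquality using (_≡_)
open import Relation.Binary.Construct.Closure.ReflexiveTransitive using (Star)

-- A finite bipartite graph G = (L, R, E) with L = Fin m, R = Fin n and
-- edge set given by the decidable adjacency  adj x y ≡ true  (x ∼ y).
-- Preferences: a ≻L b means a is preferred over b (a ∈ L), same for R.
module Greedy {m n : ℕ} (adj : Fin m → Fin n → Bool)
              (_≻L_ : Fin m → Fin m → Set) (_≻R_ : Fin n → Fin n → Set) where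

  _∼_ : Fin m → Fin n → Set
  x ∼ y = adj x y ≡ true

  -- A set of edges candidates: M x y ≡ true means {x,y} ∈ M.
  EdgeSet : Set
  EdgeSet = Fin m → Fin n → Bool

  _≐_ : EdgeSet → EdgeSet → Set
  M ≐ M' = ∀ x y → M x y ≡ M' x y

  IsMatching : EdgeSet → Set
  IsMatching M =
      (∀ x y → M x y ≡ true → x ∼ y)
    × (∀ x y y' → M x y ≡ true → M x y' ≡ true → y ≡ y')
    × (∀ x x' y → M x y ≡ true → M x' y ≡ true → x ≡ x')

  ∅ : EdgeSet
  ∅ _ _ = false

  insert : Fin m → Fin n → EdgeSet → EdgeSet
  insert x* y* M x y = M x y ∨ (⌊ x ≟ x* ⌋ ∧ ⌊ y ≟ y* ⌋)

  UnmatchedL : EdgeSet → Fin m → Set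
  UnmatchedL M x = ∀ y → M x y ≡ false

  UnmatchedR : EdgeSet → Fin n → Set
  UnmatchedR M y = ∀ x → M x y ≡ false

  InLM : EdgeSet → Fin m → Set
  InLM M x = UnmatchedL M x × ∃ λ y → UnmatchedR M y × x ∼ y

  InRM : EdgeSet → Fin n → Set
  InRM M y = UnmatchedR M y × ∃ λ x → UnmatchedL M x × x ∼ y

  MostPreferredL : (Fin m → Set) → Fin m → Set
  MostPreferredL P a = P a × (∀ b → P b → ¬ (b ≡ a) → a ≻L b)

  MostPreferredR : (Fin n → Set) → Fin n → Set
  MostPreferredR P a = P a × (∀ b → P b → ¬ (b ≡ a) → a ≻R b)

  LCond : EdgeSet → Fin m → Fin n → Set
  LCond M x* y* = MostPreferredL (InLM M) x*
                × MostPreferredR (λ y → InRM M y × x* ∼ y) y*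

  RCond : EdgeSet → Fin m → Fin n → Set
  RCond M x* y* = MostPreferredR (InRM M) y*
                × MostPreferredL (λ x → InLM M x × x ∼ y*) x*

  Arc : EdgeSet → EdgeSet → Set
  Arc M M' = IsMatching M
           × (∃ λ x → InLM M x) × (∃ λ y → InRM M y)
           × ∃ λ x* → ∃ λ y* → M' ≐ insert x* y* M
                             × (LCond M x* y* ⊎ RCond M x* y*)

  Reachable : EdgeSet → EdgeSet → Set
  Reachable = Star Arc

  Sink : EdgeSet → Set
  Sink M = ∀ M' → ¬ Arc M M'

  GreedyMatching : EdgeSet → Set
  GreedyMatching M = IsMatching M × Sink M × Reachable ∅ M

{-# OPTIONS --safe #-}
-- Every arc of D_G adds to M an edge {x, y} chosen by the L- or the R-rule, and in
-- either case y is x's most preferred available partner and x is y's. Hence two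
-- greedy edges of M either coincide or are vertex-disjoint, and each remains greedy
-- once the other has been added: two arcs out of v_M close up after one more arc
-- each. This diamond alone forces all sinks reachable from v_∅ to coincide. A sink
-- is reachable at all because every arc matches a new vertex of L.
module Submission where

open import Defs
open import Level using (0ℓ)
open import Algebra.Bundles using (CommutativeMonoid)
open import Data.Bool using (Bool; true; false; _∨_)
open import Data.Bool.Properties using (∨-commutativeMonoid; ¬-not; not-¬) renaming (_≟_ to _≟ᵇ_)
open import Data.Empty using (⊥-elim)
open import Data.Fin using (Fin; _≟_)
open import Data.Fin.Properties using (all?; any?)
open import Data.Fin.Subset using (Subset; _∈_; _⊂_)
open import Data.Fin.Subset.Induction using (⊃-wellFounded)
open import Data.List using (List; filter; allFin)
open import Data.List.Membership.Propositional.Properties using (∈-allFin; ∈-filter⁺; ∈-filter⁻)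
open import Data.List.Relation.Unary.All as All using ()
open import Data.Nat using (ℕ)
open import Data.Product using (∃; _×_; _,_; proj₁; proj₂; map₁)
open import Data.Sum using (_⊎_; inj₁; inj₂; [_,_]′)
open import Data.Vec using (tabulate)
open import Data.Vec.Properties using (lookup⇒[]=; []=⇒lookup; lookup∘tabulate)
open import Function using (flip; id; _∘_)
open import Induction.WellFounded using (WellFounded; Acc; acc; module Subrelation)
open import Relation.Binary using (Rel; Setoid; TotalOrder; _Respectsˡ_)
open import Relation.Binary.Construct.Closure.ReflexiveTransitive using (Star; ε; _◅_)
open import Relation.Binary.PropositionalEquality as ≡ using (_≡_; refl)
open import Relation.Binary.Structures using (IsStrictTotalOrder)
open import Relation.Nullary using (¬_; Dec; yes; no; _×-dec_; _→-dec_)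
open import Relation.Nullary.Decidable using (does; dec-true; dec-false; decidable-stable)
open import Relation.Unary using (Pred; Decidable)
import Algebra.Properties.CommutativeSemigroup as CommutativeSemigroupProperties
import Data.List.Extrema
import Relation.Binary.Construct.On as On
import Relation.Binary.Construct.StrictToNonStrict as StrictToNonStrict

open CommutativeSemigroupProperties (CommutativeMonoid.commutativeSemigroup ∨-commutativeMonoid)
  using (xy∙z≈xz∙y)

module RewritingModulo {a ℓ r} (S : Setoid a ℓ) (_⟶_ : Rel (Setoid.Carrier S) r)
                  (⟶-respˡ : _⟶_ Respectsˡ Setoid._≈_ S) where
  open Setoid S using (Carrier; _≈_) renaming (refl to ≈-refl; sym to ≈-sym; trans to ≈-trans)

  private
    _↠_ : Rel Carrier _
    _↠_ = Star _⟶_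
    variable
      x y s t : Carrier

  IsSink : Carrier → Set _
  IsSink x = ∀ y → ¬ x ⟶ y

  Diamond : Set _
  Diamond = ∀ {x y z} → x ⟶ y → x ⟶ z → y ≈ z ⊎ ∃ λ w → y ⟶ w × z ⟶ w

  sink-resp : x ≈ y → IsSink x → IsSink y
  sink-resp x≈y x-sink z y⟶z = x-sink z (⟶-respˡ (≈-sym x≈y) y⟶z)

  ↠-respˡ : x ≈ y → x ↠ s → ∃ λ s′ → s′ ≈ s × y ↠ s′
  ↠-respˡ x≈y ε       = _ , ≈-sym x≈y , ε
  ↠-respˡ x≈y (r ◅ p) = _ , ≈-refl , ⟶-respˡ x≈y r ◅ p

  sink-reachable : WellFounded (flip _⟶_) → (∀ x → IsSink x ⊎ ∃ (x ⟶_)) →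
                   ∀ x → ∃ λ s → x ↠ s × IsSink s
  sink-reachable wf progress x = go (wf x)
    where
    go : ∀ {x} → Acc (flip _⟶_) x → ∃ λ s → x ↠ s × IsSink s
    go {x} (acc rs) with progress x
    ... | inj₁ x-sink    = x , ε , x-sink
    ... | inj₂ (y , x⟶y) with go (rs x⟶y)
    ...   | s , y↠s , s-sink = s , x⟶y ◅ y↠s , s-sink

  module _ (diamond : Diamond) where

    strip-sink : x ↠ s → IsSink s → x ⟶ y → ∃ λ s′ → s′ ≈ s × y ↠ s′
    strip-sink ε         s-sink x⟶y = ⊥-elim (s-sink _ x⟶y)
    strip-sink (x⟶z ◅ p) s-sink x⟶y with diamond x⟶z x⟶y
    ... | inj₁ z≈y = ↠-respˡ z≈y p
    ... | inj₂ (w , z⟶w , y⟶w) with strip-sink p s-sink z⟶w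
    ...   | s′ , s′≈s , w↠s′ = s′ , s′≈s , y⟶w ◅ w↠s′

    sink-unique : x ↠ s → IsSink s → x ↠ t → IsSink t → s ≈ t
    sink-unique ε         _      ε         _      = ≈-refl
    sink-unique (x⟶y ◅ _) _      ε         t-sink = ⊥-elim (t-sink _ x⟶y)
    sink-unique p         s-sink (x⟶y ◅ q) t-sink with strip-sink p s-sink x⟶y
    ... | s′ , s′≈s , y↠s′ =
      ≈-trans (≈-sym s′≈s) (sink-unique y↠s′ (sink-resp (≈-sym s′≈s) s-sink) q t-sink)

module MostPreferredChoice {k : ℕ} {_≻_ : Rel (Fin k) 0ℓ}
                           (sto : IsStrictTotalOrder _≡_ _≻_) where
  open IsStrictTotalOrder sto using (asym)

  MostPreferred : Pred (Fin k) 0ℓ → Fin k → Set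
  MostPreferred P a = P a × (∀ b → P b → ¬ b ≡ a → a ≻ b)

  private
    variable
      P Q : Pred (Fin k) 0ℓ
      a b : Fin k

  mostPreferred-unique : MostPreferred P a → MostPreferred P b → a ≡ b
  mostPreferred-unique {a = a} {b = b} (Pa , a≻) (Pb , b≻) with a ≟ b
  ... | yes a≡b = a≡b
  ... | no  a≢b = ⊥-elim (asym (a≻ b Pb (a≢b ∘ ≡.sym)) (b≻ a Pa a≢b))

  mostPreferred-restrict : (∀ {c} → Q c → P c) → Q a → MostPreferred P a → MostPreferred Q a
  mostPreferred-restrict Q⊆P Qa (_ , a≻) = Qa , λ b Qb → a≻ b (Q⊆P Qb)

  -- _≻_ is the strict order of the record, so the most preferred element is the
  -- least one for the derived order _≻_ ∪ _≡_.
  private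
    preference : TotalOrder _ _ _
    preference = record { isTotalOrder = StrictToNonStrict.isTotalOrder _≡_ _≻_ sto }
    open Data.List.Extrema preference using (min; min≤xs; argmin-all)

  mostPreferred-exists : Decidable P → P a → ∃ (MostPreferred P)
  mostPreferred-exists {P} {a} P? Pa =
    best , argmin-all id Pa (All.tabulate (proj₂ ∘ ∈-filter⁻ P? {xs = allFin k})) , best≻
    where
    candidates : List (Fin k)
    candidates = filter P? (allFin k)
    best : Fin k
    best = min a candidates
    best≻ : ∀ b → P b → ¬ b ≡ best → best ≻ b
    best≻ b Pb b≢best with All.lookup (min≤xs a candidates) (∈-filter⁺ P? (∈-allFin b) Pb)
    ... | inj₁ best≻b    = best≻b
    ... | inj₂ best≡b    = ⊥-elim (b≢best (≡.sym best≡b))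

≢true⇒≡false : ∀ {b} → ¬ b ≡ true → b ≡ false
≢true⇒≡false = ¬-not

module GreedyProperties {m n : ℕ} (adj : Fin m → Fin n → Bool)
                        {_≻L_ : Rel (Fin m) 0ℓ} {_≻R_ : Rel (Fin n) 0ℓ}
                        (stoL : IsStrictTotalOrder _≡_ _≻L_) (stoR : IsStrictTotalOrder _≡_ _≻R_) where
  open Greedy adj _≻L_ _≻R_
  private
    module L = MostPreferredChoice stoL
    module R = MostPreferredChoice stoR
    variable
      M M′ N N′ : EdgeSet
      x x′ a : Fin m
      y y′ b : Fin n

  -- Edge sets are Boolean functions and there is no function extensionality, so D_G
  -- is handled up to pointwise equality: two arcs adding the same edge to M reach
  -- ≐-equal, not ≡-equal, edge sets.
  ≐-setoid : Setoid 0ℓ 0ℓ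
  ≐-setoid = record
    { Carrier       = EdgeSet
    ; _≈_           = _≐_
    ; isEquivalence = record
      { refl  = λ _ _ → refl
      ; sym   = λ e x y → ≡.sym (e x y)
      ; trans = λ e f x y → ≡.trans (e x y) (f x y)
      }
    }
  open Setoid ≐-setoid using () renaming (refl to ≐-refl; sym to ≐-sym; trans to ≐-trans)

  infix 4 _⊆ₑ_
  _⊆ₑ_ : EdgeSet → EdgeSet → Set
  M ⊆ₑ N = ∀ {x y} → M x y ≡ true → N x y ≡ true

  ≐⇒⊆ₑ : M ≐ N → M ⊆ₑ N
  ≐⇒⊆ₑ M≐N {x} {y} h = ≡.trans (≡.sym (M≐N x y)) h

  insert-true⁻ : insert x y M a b ≡ true → M a b ≡ true ⊎ (a ≡ x × b ≡ y)
  insert-true⁻ {x} {y} {M} {a} {b} h with M a b | a ≟ x | b ≟ y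
  ... | true  | _         | _         = inj₁ refl
  ... | false | yes a≡x   | yes b≡y   = inj₂ (a≡x , b≡y)
  insert-true⁻ () | false | yes _ | no _
  insert-true⁻ () | false | no _  | _

  ⊆ₑ-insert : M ⊆ₑ insert x y M
  ⊆ₑ-insert h rewrite h = refl

  insert-self : insert x y M x y ≡ true
  insert-self {x} {y} {M} with M x y | x ≟ x | y ≟ y
  ... | true  | _       | _       = refl
  ... | false | yes _   | yes _   = refl
  ... | false | no x≢x  | _       = ⊥-elim (x≢x refl)
  ... | false | yes _   | no y≢y  = ⊥-elim (y≢y refl)

  insert-cong : M ≐ N → insert x y M ≐ insert x y N
  insert-cong M≐N a b = ≡.cong (_∨ _) (M≐N a b)

  insert-comm : insert x y (insert x′ y′ M) ≐ insert x′ y′ (insert x y M)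
  insert-comm {M = M} a b = xy∙z≈xz∙y (M a b) _ _

  unmatchedL-antitone : M ⊆ₑ N → UnmatchedL N x → UnmatchedL M x
  unmatchedL-antitone M⊆N u y = ≢true⇒≡false λ h → not-¬ (M⊆N h) (u y)

  unmatchedR-antitone : M ⊆ₑ N → UnmatchedR N y → UnmatchedR M y
  unmatchedR-antitone M⊆N u x = ≢true⇒≡false λ h → not-¬ (M⊆N h) (u x)

  unmatchedL-insert : ¬ a ≡ x → UnmatchedL M a → UnmatchedL (insert x y M) a
  unmatchedL-insert {x = x} {M = M} {y = y} a≢x u b =
    ≢true⇒≡false λ h → [ (λ h′ → not-¬ h′ (u b)) , a≢x ∘ proj₁ ]′ (insert-true⁻ {x} {y} {M} h)

  unmatchedR-insert : ¬ b ≡ y → UnmatchedR M b → UnmatchedR (insert x y M) b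
  unmatchedR-insert {y = y} {M = M} {x = x} b≢y u a =
    ≢true⇒≡false λ h → [ (λ h′ → not-¬ h′ (u a)) , b≢y ∘ proj₂ ]′ (insert-true⁻ {x} {y} {M} h)

  inLM-antitone : M ⊆ₑ N → InLM N x → InLM M x
  inLM-antitone {M} M⊆N (ux , y , uy , x∼y) =
    unmatchedL-antitone {M} M⊆N ux , y , unmatchedR-antitone {M} M⊆N uy , x∼y

  inRM-antitone : M ⊆ₑ N → InRM N y → InRM M y
  inRM-antitone {M} M⊆N (uy , x , ux , x∼y) =
    unmatchedR-antitone {M} M⊆N uy , x , unmatchedL-antitone {M} M⊆N ux , x∼y

  Available : EdgeSet → Fin m → Fin n → Set
  Available M x y = UnmatchedL M x × UnmatchedR M y × x ∼ y

  available-inLM : Available M x y → InLM M x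
  available-inLM (ux , uy , x∼y) = ux , _ , uy , x∼y

  available-inRM : Available M x y → InRM M y
  available-inRM (ux , uy , x∼y) = uy , _ , ux , x∼y

  available-antitone : M ⊆ₑ N → Available N x y → Available M x y
  available-antitone {M} M⊆N (ux , uy , x∼y) =
    unmatchedL-antitone {M} M⊆N ux , unmatchedR-antitone {M} M⊆N uy , x∼y

  available-insert : ¬ a ≡ x → ¬ b ≡ y → Available M a b → Available (insert x y M) a b
  available-insert {x = x} {y = y} {M = M} a≢x b≢y (ua , ub , a∼b) =
    unmatchedL-insert {x = x} {M = M} {y = y} a≢x ua ,
    unmatchedR-insert {y = y} {M = M} {x = x} b≢y ub ,
    a∼b

  ∅-isMatching : IsMatching ∅
  ∅-isMatching = (λ _ _ ()) , (λ _ _ _ ()) , (λ _ _ _ ())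

  isMatching-antitone : M ⊆ₑ N → IsMatching N → IsMatching M
  isMatching-antitone M⊆N (edges , uniqueʳ , uniqueˡ) =
    (λ x y h → edges x y (M⊆N h)) ,
    (λ x y y′ h h′ → uniqueʳ x y y′ (M⊆N h) (M⊆N h′)) ,
    (λ x x′ y h h′ → uniqueˡ x x′ y (M⊆N h) (M⊆N h′))

  insert-isMatching : IsMatching M → Available M x y → IsMatching (insert x y M)
  insert-isMatching {M} {x} {y} (edges , uniqueʳ , uniqueˡ) (ux , uy , x∼y) = edges′ , uniqueʳ′ , uniqueˡ′
    where
    edges′ : ∀ a b → insert x y M a b ≡ true → a ∼ b
    edges′ a b h with insert-true⁻ {x} {y} {M} h
    ... | inj₁ h′              = edges a b h′
    ... | inj₂ (refl , refl)   = x∼y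
    uniqueʳ′ : ∀ a b b′ → insert x y M a b ≡ true → insert x y M a b′ ≡ true → b ≡ b′
    uniqueʳ′ a b b′ h h′ with insert-true⁻ {x} {y} {M} h | insert-true⁻ {x} {y} {M} h′
    ... | inj₁ g             | inj₁ g′            = uniqueʳ a b b′ g g′
    ... | inj₁ g             | inj₂ (refl , refl) = ⊥-elim (not-¬ g (ux b))
    ... | inj₂ (refl , refl) | inj₁ g′            = ⊥-elim (not-¬ g′ (ux b′))
    ... | inj₂ (refl , refl) | inj₂ (refl , refl) = refl
    uniqueˡ′ : ∀ a a′ b → insert x y M a b ≡ true → insert x y M a′ b ≡ true → a ≡ a′
    uniqueˡ′ a a′ b h h′ with insert-true⁻ {x} {y} {M} h | insert-true⁻ {x} {y} {M} h′
    ... | inj₁ g             | inj₁ g′            = uniqueˡ a a′ b g g′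
    ... | inj₁ g             | inj₂ (refl , refl) = ⊥-elim (not-¬ g (uy a))
    ... | inj₂ (refl , refl) | inj₁ g′            = ⊥-elim (not-¬ g′ (uy a′))
    ... | inj₂ (refl , refl) | inj₂ (refl , refl) = refl

  GreedyEdge : EdgeSet → Fin m → Fin n → Set
  GreedyEdge M x y = LCond M x y ⊎ RCond M x y

  greedyEdge-available : GreedyEdge M x y → Available M x y
  greedyEdge-available (inj₁ (((ux , _) , _) , ((uy , _) , x∼y) , _)) = ux , uy , x∼y
  greedyEdge-available (inj₂ (((uy , _) , _) , ((ux , _) , x∼y) , _)) = ux , uy , x∼y

  greedyEdge-bestPartnerʳ : GreedyEdge M x y → MostPreferredR (λ y′ → InRM M y′ × x ∼ y′) y
  greedyEdge-bestPartnerʳ (inj₁ (_ , best)) = best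
  greedyEdge-bestPartnerʳ (inj₂ (best , ((_ , x∼y) , _))) =
    R.mostPreferred-restrict proj₁ (proj₁ best , x∼y) best

  greedyEdge-bestPartnerˡ : GreedyEdge M x y → MostPreferredL (λ x′ → InLM M x′ × x′ ∼ y) x
  greedyEdge-bestPartnerˡ (inj₁ (best , ((_ , x∼y) , _))) =
    L.mostPreferred-restrict proj₁ (proj₁ best , x∼y) best
  greedyEdge-bestPartnerˡ (inj₂ (_ , best)) = best

  greedyEdge-uniqueʳ : GreedyEdge M x y → GreedyEdge M x′ y′ → x ≡ x′ → y ≡ y′
  greedyEdge-uniqueʳ g g′ refl =
    R.mostPreferred-unique (greedyEdge-bestPartnerʳ g) (greedyEdge-bestPartnerʳ g′)

  greedyEdge-uniqueˡ : GreedyEdge M x y → GreedyEdge M x′ y′ → y ≡ y′ → x ≡ x′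
  greedyEdge-uniqueˡ g g′ refl =
    L.mostPreferred-unique (greedyEdge-bestPartnerˡ g) (greedyEdge-bestPartnerˡ g′)

  greedyEdge-⊆ₑ : M ⊆ₑ N → Available N x y → GreedyEdge M x y → GreedyEdge N x y
  greedyEdge-⊆ₑ {M} M⊆N av@(_ , _ , x∼y) (inj₁ (bestx , besty)) =
    inj₁ (L.mostPreferred-restrict (inLM-antitone {M} M⊆N) (available-inLM av) bestx ,
          R.mostPreferred-restrict (map₁ (inRM-antitone {M} M⊆N)) (available-inRM av , x∼y) besty)
  greedyEdge-⊆ₑ {M} M⊆N av@(_ , _ , x∼y) (inj₂ (besty , bestx)) =
    inj₂ (R.mostPreferred-restrict (inRM-antitone {M} M⊆N) (available-inRM av) besty ,
          L.mostPreferred-restrict (map₁ (inLM-antitone {M} M⊆N)) (available-inLM av , x∼y) bestx)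

  greedyArc : IsMatching M → GreedyEdge M x y → Arc M (insert x y M)
  greedyArc {M} {x} {y} isM g =
    isM , (x , available-inLM av) , (y , available-inRM av) , x , y , ≐-refl , g
    where
    av : Available M x y
    av = greedyEdge-available g

  arc-respʳ : N ≐ N′ → Arc M N → Arc M N′
  arc-respʳ N≐N′ (isM , L≠∅ , R≠∅ , x , y , N≐ , g) =
    isM , L≠∅ , R≠∅ , x , y , ≐-trans (≐-sym N≐N′) N≐ , g

  arc-respˡ : M ≐ M′ → Arc M N → Arc M′ N
  arc-respˡ {M} {M′} M≐M′ (isM , _ , _ , x , y , N≐ , g) =
    arc-respʳ (≐-trans (insert-cong (≐-sym M≐M′)) (≐-sym N≐))
      (greedyArc (isMatching-antitone M′⊆M isM)
                 (greedyEdge-⊆ₑ {M} (≐⇒⊆ₑ M≐M′) (available-antitone {M′} M′⊆M (greedyEdge-available g)) g))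
    where
    M′⊆M : M′ ⊆ₑ M
    M′⊆M = ≐⇒⊆ₑ (≐-sym M≐M′)

  arc-⊆ₑ : Arc M N → M ⊆ₑ N
  arc-⊆ₑ {M} (_ , _ , _ , x , y , N≐ , _) h = ≐⇒⊆ₑ (≐-sym N≐) (⊆ₑ-insert {M} {x = x} {y = y} h)

  arc-isMatching : Arc M N → IsMatching N
  arc-isMatching (isM , _ , _ , _ , _ , N≐ , g) =
    isMatching-antitone (≐⇒⊆ₑ N≐) (insert-isMatching isM (greedyEdge-available g))

  reachable-isMatching : IsMatching M → Reachable M N → IsMatching N
  reachable-isMatching isM ε           = isM
  reachable-isMatching _   (arc ◅ arcs) = reachable-isMatching (arc-isMatching arc) arcs

  open RewritingModulo ≐-setoid Arc arc-respˡ public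

  arc-diamond : Diamond
  arc-diamond {M} (isM , _ , _ , x₁ , y₁ , N₁≐ , g₁) (_ , _ , _ , x₂ , y₂ , N₂≐ , g₂) with x₁ ≟ x₂
  ... | yes refl with refl ← greedyEdge-uniqueʳ g₁ g₂ refl = inj₁ (≐-trans N₁≐ (≐-sym N₂≐))
  ... | no x₁≢x₂ =
    inj₂ (insert x₂ y₂ (insert x₁ y₁ M) ,
          arc-respˡ (≐-sym N₁≐) (arcAfter g₁ g₂ (x₁≢x₂ ∘ ≡.sym) (y₁≢y₂ ∘ ≡.sym)) ,
          arc-respˡ (≐-sym N₂≐) (arc-respʳ insert-comm (arcAfter g₂ g₁ x₁≢x₂ y₁≢y₂)))
    where
    y₁≢y₂ : ¬ y₁ ≡ y₂
    y₁≢y₂ = x₁≢x₂ ∘ greedyEdge-uniqueˡ g₁ g₂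
    arcAfter : GreedyEdge M x y → GreedyEdge M x′ y′ → ¬ x′ ≡ x → ¬ y′ ≡ y →
             Arc (insert x y M) (insert x′ y′ (insert x y M))
    arcAfter {x} {y} g g′ x′≢x y′≢y =
      greedyArc (insert-isMatching isM (greedyEdge-available g))
        (greedyEdge-⊆ₑ {M} (⊆ₑ-insert {M} {x = x} {y = y})
          (available-insert {x = x} {y = y} {M = M} x′≢x y′≢y (greedyEdge-available g′)) g′)

  matchedL : EdgeSet → Subset m
  matchedL M = tabulate λ x → does (any? λ y → M x y ≟ᵇ true)

  ∈-matchedL⁺ : M x y ≡ true → x ∈ matchedL M
  ∈-matchedL⁺ {M} {x} {y} h =
    lookup⇒[]= x (matchedL M) (≡.trans (lookup∘tabulate _ x) (dec-true (any? _) (y , h)))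

  ∈-matchedL⁻ : x ∈ matchedL M → ∃ λ y → M x y ≡ true
  ∈-matchedL⁻ {x} {M} x∈ = decidable-stable (any? λ y → M x y ≟ᵇ true) λ ¬matched →
    not-¬ (≡.trans (≡.sym (lookup∘tabulate _ x)) ([]=⇒lookup x∈)) (dec-false (any? _) ¬matched)

  arc-matchedL-⊂ : Arc M N → matchedL M ⊂ matchedL N
  arc-matchedL-⊂ {M} arc@(_ , _ , _ , x , y , N≐ , g) =
    (λ x∈ → ∈-matchedL⁺ (arc-⊆ₑ arc (proj₂ (∈-matchedL⁻ x∈)))) ,
    x , ∈-matchedL⁺ (≐⇒⊆ₑ (≐-sym N≐) (insert-self {x} {y} {M})) ,
    λ x∈ → not-¬ (proj₂ (∈-matchedL⁻ x∈)) (proj₁ (greedyEdge-available g) _)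

  arcs-wellFounded : WellFounded (flip Arc)
  arcs-wellFounded = Subrelation.wellFounded arc-matchedL-⊂ (On.wellFounded matchedL ⊃-wellFounded)

  adj? : ∀ x y → Dec (x ∼ y)
  adj? x y = adj x y ≟ᵇ true

  unmatchedL? : ∀ M x → Dec (UnmatchedL M x)
  unmatchedL? M x = all? λ y → M x y ≟ᵇ false

  unmatchedR? : ∀ M y → Dec (UnmatchedR M y)
  unmatchedR? M y = all? λ x → M x y ≟ᵇ false

  inLM? : ∀ M x → Dec (InLM M x)
  inLM? M x = unmatchedL? M x ×-dec any? λ y → unmatchedR? M y ×-dec adj? x y

  inRM? : ∀ M y → Dec (InRM M y)
  inRM? M y = unmatchedR? M y ×-dec any? λ x → unmatchedL? M x ×-dec adj? x y

  isMatching? : ∀ M → Dec (IsMatching M)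
  isMatching? M =
    all? (λ x → all? λ y → M x y ≟ᵇ true →-dec adj? x y) ×-dec
    all? (λ x → all? λ y → all? λ y′ → M x y ≟ᵇ true →-dec M x y′ ≟ᵇ true →-dec y ≟ y′) ×-dec
    all? (λ x → all? λ x′ → all? λ y → M x y ≟ᵇ true →-dec M x′ y ≟ᵇ true →-dec x ≟ x′)

  arc-progress : ∀ M → Sink M ⊎ ∃ (Arc M)
  arc-progress M with isMatching? M | any? (inLM? M)
  ... | no ¬isM | _        = inj₁ λ _ arc → ¬isM (proj₁ arc)
  ... | yes _   | no L_M≡∅ = inj₁ λ _ arc → L_M≡∅ (proj₁ (proj₂ arc))
  ... | yes isM | yes (_ , x₀∈L_M)
    with x , bestx@((ux , y₀ , uy₀ , x∼y₀) , _) ← L.mostPreferred-exists (inLM? M) x₀∈L_M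
    with y , besty ← R.mostPreferred-exists (λ y → inRM? M y ×-dec adj? x y) ((uy₀ , x , ux , x∼y₀) , x∼y₀)
    = inj₂ (_ , greedyArc isM (inj₁ (bestx , besty)))

theorem1 : (m n : ℕ) (adj : Fin m → Fin n → Bool)
    (_≻L_ : Fin m → Fin m → Set) (_≻R_ : Fin n → Fin n → Set) →
    IsStrictTotalOrder _≡_ _≻L_ → IsStrictTotalOrder _≡_ _≻R_ →
    let open Greedy adj _≻L_ _≻R_ in
    ∃ λ M → GreedyMatching M × (∀ M' → GreedyMatching M' → M' ≐ M)
theorem1 m n adj _≻L_ _≻R_ stoL stoR =
  let S , ∅↠S , S-sink = sink-reachable arcs-wellFounded arc-progress ∅ in
  S , (reachable-isMatching ∅-isMatching ∅↠S , S-sink , ∅↠S) ,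
  λ { M (_ , M-sink , ∅↠M) → sink-unique arc-diamond ∅↠M M-sink ∅↠S S-sink }
  where
  open Greedy adj _≻L_ _≻R_
  open GreedyProperties adj stoL stoR
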